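{- Let $\mathbf C$ be a category with finite coproducts. Declaring $f\colon X\to Y$ to be $\sigma$-guarded iff $f$ is vacuously $\sigma$-guarded yields a guardedness relation making $\mathbf C$ an abstractly guarded category, and it is the least such relation (contained in every relation making $\mathbf C$ abstractly guarded).
   Context: A summand $\sigma\colon Z\triangleleft Y$ is a pair $(\sigma_1\colon Z\to Y,\sigma_2\colon Z'\to Y)$ forming a coproduct cospan; its complement is $\bar\sigma=(\sigma_2,\sigma_1)$. $f\colon X\to Y$ is vacuously $\sigma$-guarded if $f$ factors through $\bar\sigma$ (i.e. through $\sigma_2$). A relation $f\colon X\to_\sigma Y$ makes $\mathbf C$ abstractly guarded if closed under: (trv) $\mathrm{inl}\circ f\colon X\to_{\mathrm{inr}}Y+Z$ for all $f\colon X\to Y$; (par) $f\colon X\to_\sigma Z$, $g\colon Y\to_\sigma Z$ imply $[f,g]\colon X+Y\to_\sigma Z$; (cmp) $f\colon X\to_{\mathrm{inr}}Y+Z$, $g\colon Y\to_\sigma V$, $h\colon Z\to V$ imply $[g,h]\circ f\colon X\to_\sigma V$; here $Y+Z$ ranges over all coproducts. -}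

module Defs where

open import Level using (Level; _⊔_; suc)
open import Data.Product using (Σ; _×_; _,_)
open import Relation.Binary.PropositionalEquality using (_≡_)

record Category (o h : Level) : Set (suc (o ⊔ h)) where
  infixr 9 _∘_
  field
    Obj : Set o
    Hom : Obj → Obj → Set h
    id  : ∀ {A} → Hom A A
    _∘_ : ∀ {A B C} → Hom B C → Hom A B → Hom A C
    identityˡ : ∀ {A B} {f : Hom A B} → id ∘ f ≡ f
    identityʳ : ∀ {A B} {f : Hom A B} → f ∘ id ≡ f
    assoc : ∀ {A B C D} {f : Hom A B} {g : Hom B C} {k : Hom C D} →
            (k ∘ g) ∘ f ≡ k ∘ (g ∘ f)

module _ {o h : Level} (𝐂 : Category o h) where
  open Category 𝐂

  record IsCoproduct {A B S : Obj} (i₁ : Hom A S) (i₂ : Hom B S) : Set (o ⊔ h) where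
    field
      [_,_]  : ∀ {C} → Hom A C → Hom B C → Hom S C
      inject₁ : ∀ {C} {f : Hom A C} {g : Hom B C} → [ f , g ] ∘ i₁ ≡ f
      inject₂ : ∀ {C} {f : Hom A C} {g : Hom B C} → [ f , g ] ∘ i₂ ≡ g
      unique  : ∀ {C} {f : Hom A C} {g : Hom B C} {k : Hom S C} →
                k ∘ i₁ ≡ f → k ∘ i₂ ≡ g → k ≡ [ f , g ]

  swapIsCoproduct : ∀ {A B S} {i₁ : Hom A S} {i₂ : Hom B S} →
                    IsCoproduct i₁ i₂ → IsCoproduct i₂ i₁
  swapIsCoproduct c = record
    { [_,_]   = λ f g → [ g , f ]
    ; inject₁ = inject₂
    ; inject₂ = inject₁
    ; unique  = λ p q → unique q p
    }
    where open IsCoproduct c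

  -- A coproduct Y + Z of Y and Z (any one, not a chosen one).
  record Coproduct (Y Z : Obj) : Set (o ⊔ h) where
    field
      obj : Obj
      inl : Hom Y obj
      inr : Hom Z obj
      isCoproduct : IsCoproduct inl inr
    open IsCoproduct isCoproduct public

  record Initial : Set (o ⊔ h) where
    field
      ⊥ : Obj
      ! : ∀ {A} → Hom ⊥ A
      !-unique : ∀ {A} (f : Hom ⊥ A) → f ≡ !

  record FiniteCoproducts : Set (o ⊔ h) where
    field
      initial : Initial
      coproduct : ∀ (A B : Obj) → Coproduct A B

  record Summand (Y : Obj) : Set (o ⊔ h) where
    field
      Z  : Obj
      Z' : Obj
      σ₁ : Hom Z Y
      σ₂ : Hom Z' Y
      isCoproduct : IsCoproduct σ₁ σ₂

  complement : ∀ {Y} → Summand Y → Summand Y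
  complement σ = record
    { Z = Z' ; Z' = Z ; σ₁ = σ₂ ; σ₂ = σ₁ ; isCoproduct = swapIsCoproduct isCoproduct }
    where open Summand σ

  inrSummand : ∀ {Y Z} → (c : Coproduct Y Z) → Summand (Coproduct.obj c)
  inrSummand c = record
    { Z = _ ; Z' = _ ; σ₁ = inr ; σ₂ = inl ; isCoproduct = swapIsCoproduct isCoproduct }
    where open Coproduct c

  GuardRel : (ℓ : Level) → Set (o ⊔ h ⊔ suc ℓ)
  GuardRel ℓ = ∀ {X Y : Obj} → Summand Y → Hom X Y → Set ℓ

  VacuouslyGuarded : GuardRel h
  VacuouslyGuarded {X} σ f = Σ (Hom X (Summand.Z' σ)) λ g → f ≡ Summand.σ₂ σ ∘ g

  record IsAbstractlyGuarded {ℓ : Level} (R : GuardRel ℓ) : Set (o ⊔ h ⊔ ℓ) where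
    field
      trv : ∀ {X Y Z} (c : Coproduct Y Z) (f : Hom X Y) →
            R (inrSummand c) (Coproduct.inl c ∘ f)
      par : ∀ {X Y V} (c : Coproduct X Y) (σ : Summand V)
              {f : Hom X V} {g : Hom Y V} →
            R σ f → R σ g → R σ (Coproduct.[_,_] c f g)
      cmp : ∀ {X Y Z V} (c : Coproduct Y Z) (σ : Summand V)
              {f : Hom X (Coproduct.obj c)} {g : Hom Y V} {k : Hom Z V} →
            R (inrSummand c) f → R σ g → R σ (Coproduct.[_,_] c g k ∘ f)

-- A vacuously σ-guarded morphism σ₂ ∘ g is literally an instance of (trv): reading σ as the
-- coproduct cospan (σ₂, σ₁), the summand inr of that coproduct is σ itself.  Closure of the
-- vacuous relation under (par) and (cmp) is copairing and composition of the factorisations.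
module Submission where

open import Defs
open import Level using (Level)
open import Data.Product using (_×_; _,_)
open import Relation.Binary.PropositionalEquality using (_≡_; refl; sym; trans; cong; cong₂; subst; module ≡-Reasoning)

module _ {o h : Level} (𝐂 : Category o h) where
  open Category 𝐂
  open ≡-Reasoning

  ∘-distribˡ-[] : ∀ {Y Z V W} (c : Coproduct 𝐂 Y Z) {f : Hom Y V} {g : Hom Z V} (k : Hom V W) →
                  k ∘ Coproduct.[_,_] c f g ≡ Coproduct.[_,_] c (k ∘ f) (k ∘ g)
  ∘-distribˡ-[] c k = unique (trans assoc (cong (k ∘_) inject₁)) (trans assoc (cong (k ∘_) inject₂))
    where open Coproduct c

  summandCoproduct : ∀ {Y} (σ : Summand 𝐂 Y) → Coproduct 𝐂 (Summand.Z' σ) (Summand.Z σ)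
  summandCoproduct σ = record
    { inl = σ₂ ; inr = σ₁ ; isCoproduct = swapIsCoproduct 𝐂 isCoproduct }
    where open Summand σ

  inrSummand-summandCoproduct : ∀ {Y} (σ : Summand 𝐂 Y) → inrSummand 𝐂 (summandCoproduct σ) ≡ σ
  inrSummand-summandCoproduct σ = refl

  vacuouslyGuarded-trv : ∀ {X Y Z} (c : Coproduct 𝐂 Y Z) (f : Hom X Y) →
                         VacuouslyGuarded 𝐂 (inrSummand 𝐂 c) (Coproduct.inl c ∘ f)
  vacuouslyGuarded-trv c f = f , refl

  vacuouslyGuarded-par : ∀ {X Y V} (c : Coproduct 𝐂 X Y) (σ : Summand 𝐂 V) {f : Hom X V} {g : Hom Y V} →
                         VacuouslyGuarded 𝐂 σ f → VacuouslyGuarded 𝐂 σ g →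
                         VacuouslyGuarded 𝐂 σ (Coproduct.[_,_] c f g)
  vacuouslyGuarded-par c σ {f} {g} (f′ , f≡σ₂f′) (g′ , g≡σ₂g′) = [ f′ , g′ ] , (begin
    [ f , g ]             ≡⟨ cong₂ [_,_] f≡σ₂f′ g≡σ₂g′ ⟩
    [ σ₂ ∘ f′ , σ₂ ∘ g′ ] ≡⟨ sym (∘-distribˡ-[] c σ₂) ⟩
    σ₂ ∘ [ f′ , g′ ]      ∎)
    where
    open Coproduct c
    open Summand σ

  vacuouslyGuarded-cmp : ∀ {X Y Z V} (c : Coproduct 𝐂 Y Z) (σ : Summand 𝐂 V)
                         {f : Hom X (Coproduct.obj c)} {g : Hom Y V} {k : Hom Z V} →
                         VacuouslyGuarded 𝐂 (inrSummand 𝐂 c) f → VacuouslyGuarded 𝐂 σ g →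
                         VacuouslyGuarded 𝐂 σ (Coproduct.[_,_] c g k ∘ f)
  vacuouslyGuarded-cmp c σ {f} {g} {k} (f′ , f≡inlf′) (g′ , g≡σ₂g′) = g′ ∘ f′ , (begin
    [ g , k ] ∘ f           ≡⟨ cong ([ g , k ] ∘_) f≡inlf′ ⟩
    [ g , k ] ∘ (inl ∘ f′)  ≡⟨ sym assoc ⟩
    ([ g , k ] ∘ inl) ∘ f′  ≡⟨ cong (_∘ f′) inject₁ ⟩
    g ∘ f′                  ≡⟨ cong (_∘ f′) g≡σ₂g′ ⟩
    (σ₂ ∘ g′) ∘ f′          ≡⟨ assoc ⟩
    σ₂ ∘ (g′ ∘ f′)          ∎)
    where
    open Coproduct c
    open Summand σ

  vacuouslyGuarded-isAbstractlyGuarded : IsAbstractlyGuarded 𝐂 (VacuouslyGuarded 𝐂)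
  vacuouslyGuarded-isAbstractlyGuarded = record
    { trv = vacuouslyGuarded-trv
    ; par = vacuouslyGuarded-par
    ; cmp = vacuouslyGuarded-cmp
    }

  vacuouslyGuarded⊆ : ∀ {ℓ} (R : GuardRel 𝐂 ℓ) → IsAbstractlyGuarded 𝐂 R →
                      ∀ {X Y} (σ : Summand 𝐂 Y) (f : Hom X Y) → VacuouslyGuarded 𝐂 σ f → R σ f
  vacuouslyGuarded⊆ R isAG σ f (g , f≡σ₂g) =
    subst (R σ) (sym f≡σ₂g)
      (subst (λ τ → R τ (Summand.σ₂ σ ∘ g)) (inrSummand-summandCoproduct σ)
        (IsAbstractlyGuarded.trv isAG (summandCoproduct σ) g))

proposition3p5 : ∀ {o h ℓ : Level} (𝐂 : Category o h) → FiniteCoproducts 𝐂 →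
    IsAbstractlyGuarded 𝐂 (VacuouslyGuarded 𝐂)
    × ((R : GuardRel 𝐂 ℓ) → IsAbstractlyGuarded 𝐂 R →
       ∀ {X Y} (σ : Summand 𝐂 Y) (f : Category.Hom 𝐂 X Y) →
       VacuouslyGuarded 𝐂 σ f → R σ f)
proposition3p5 𝐂 _ = vacuouslyGuarded-isAbstractlyGuarded 𝐂 , vacuouslyGuarded⊆ 𝐂
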